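{- Let $\mathcal{P}$ be a client/server system, $s$ a global state of $\mathrm{TS}(\mathcal{P})$ and $B$ a set of actions. Then $\mathit{IFS}(s,B)$ implies $\mathit{PIFS}(s,B)$, and $\mathit{PIFS}(s,B)$ implies $\mathit{rPIFS}(s,B)$.
   Context: A client/server system $\mathcal{P}$: a finite set of processes $\mathit{Proc}=\mathit{Clients}\cup\mathit{Servers}$ (disjoint), each $p$ with a finite action-deterministic transition system $\mathrm{TS}_p$ over actions $\Sigma_p$, clients' systems acyclic; $\mathit{dom}(a)=\{p:a\in\Sigma_p\}$ consists of exactly one client and one server. $\mathrm{TS}(\mathcal{P})$: global states are tuples $(s_p)_p$, $s\xrightarrow{a}s'$ iff $s_p\xrightarrow{a}s'_p$ in $\mathrm{TS}_p$ for $p\in\mathit{dom}(a)$ and $s'_p=s_p$ otherwise. We write $s_p\xrightarrow{w}_p$ if there is a path labelled $w$ from $s_p$ in $\mathrm{TS}_p$. $\mathit{enabled}(s)$ is the set of labels of transitions leaving $s$ in $\mathrm{TS}(\mathcal{P})$. For a sequence or set of actions $X$, $\mathit{dom}(X)$ is the union of the domains of its actions. A run is a path; a maximal run ends in a state without outgoing transitions. Actions $a,b$ are independent if $\mathit{dom}(a)\cap\mathit{dom}(b)=\emptyset$; $u\sim w$ if $w$ is obtained from $u$ by repeatedly swapping adjacent independent actions; $\mathit{first}(u)=\{b:\exists v.\ bv\sim u\}$. $\mathit{IFS}(s,B)$ holds iff there is a maximal run $u$ from $s$ with $\mathit{first}(u)\subseteq B$. An action $c$ sticks from a set of processes $R$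 in $s$ if $\mathit{dom}(c)=\{p,q\}$ with $p\in R$, $q\notin R$, and $s_q\xrightarrow{c}_q$. A set of processes $R$ wraps $\mathit{enabled}(s)$ if $\mathit{dom}(a)\cap R\neq\emptyset$ for every $a\in\mathit{enabled}(s)$. $\mathit{PIFS}(s,B)$ holds if there is a sequence $B=B_0\subseteq B_1\subseteq\dots\subseteq B_k$ such that $B_{i+1}=B_i\cup C_i$, where $C_i$ is the set of actions $c$ for which there are a process $p$ and an action $b\in B_i$ with $c$ sticking from $\{p\}$ in $s$ and a local path $s_p\xrightarrow{b}_p\xrightarrow{x}_p\xrightarrow{c}_p$ for some sequence $x$ with $\mathit{dom}(x)\subseteq\mathit{dom}(B_i)$; and $\mathit{dom}(B_k)$ wraps $\mathit{enabled}(s)$. $\mathit{rPIFS}(s,B)$ is defined identically except that the requirement $\mathit{dom}(x)\subseteq\mathit{dom}(B_i)$ is dropped. -}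

module Defs where

open import Data.Nat using (ℕ)
open import Data.Fin using (Fin)
open import Data.Bool using (Bool; true; false)
open import Data.Maybe using (Maybe; just; nothing)
open import Data.List using (List; []; _∷_; _++_; [_])
open import Data.List.Membership.Propositional using (_∈_)
open import Data.List.Relation.Unary.All using (All)
open import Data.Product using (Σ; ∃; ∃-syntax; _×_; _,_)
open import Data.Sum using (_⊎_)
open import Data.Empty using (⊥)
open import Data.Unit using (⊤)
open import Relation.Nullary using (¬_)
open import Relation.Binary.PropositionalEquality using (_≡_; _≢_)
open import Relation.Binary.Construct.Closure.ReflexiveTransitive using (Star)

-- Every action a has
-- dom(a) = {cl a, sv a}, with cl a a client and sv a a server (so
-- exactly one client and one server).  Σ_p = {a | p ∈ dom a}.
-- Each process p has finitely many local states Fin (nS p) and an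
-- action-deterministic transition system given as a partial function
-- δ p : state → action → Maybe state, only defined on actions of Σ_p.

record RawCS : Set where
  field
    nP        : ℕ
    isClient  : Fin nP → Bool
    nA        : ℕ
    cl        : Fin nA → Fin nP
    sv        : Fin nA → Fin nP
    cl-client : ∀ a → isClient (cl a) ≡ true
    sv-server : ∀ a → isClient (sv a) ≡ false
    nS        : Fin nP → ℕ
    δ         : (p : Fin nP) → Fin (nS p) → Fin nA → Maybe (Fin (nS p))
    δ-Σ       : ∀ p s a → δ p s a ≢ nothing → (p ≡ cl a) ⊎ (p ≡ sv a)

module _ (R : RawCS) where
  open RawCS R

  Proc : Set
  Proc = Fin nP

  Act : Set
  Act = Fin nA

  LState : Proc → Set
  LState p = Fin (nS p)

  _∈dom_ : Proc → Act → Set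
  p ∈dom a = (p ≡ cl a) ⊎ (p ≡ sv a)

  data LPath (p : Proc) : LState p → List Act → LState p → Set where
    lnil  : ∀ {s} → LPath p s [] s
    lcons : ∀ {s a t w u} → δ p s a ≡ just t → LPath p t w u → LPath p s (a ∷ w) u

  LCan : (p : Proc) → LState p → List Act → Set
  LCan p s w = ∃[ t ] LPath p s w t

  Acyclic : Proc → Set
  Acyclic p = ∀ (s : LState p) (w : List Act) → LPath p s w s → w ≡ []

record CSSystem : Set where
  field
    raw            : RawCS
    clients-acyclic : ∀ p → RawCS.isClient raw p ≡ true → Acyclic raw p
  open RawCS raw public

module CS (𝒫 : CSSystem) where
  open CSSystem 𝒫

  Pr : Set
  Pr = Proc raw

  Ac : Set
  Ac = Act raw

  _∈d_ : Pr → Ac → Set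
  p ∈d a = _∈dom_ raw p a

  GState : Set
  GState = (p : Pr) → LState raw p

  Step : GState → Ac → GState → Set
  Step s a t = (∀ p → p ∈d a → δ p (s p) a ≡ just (t p))
             × (∀ p → ¬ (p ∈d a) → t p ≡ s p)

  data Run : GState → List Ac → GState → Set where
    rnil  : ∀ {s} → Run s [] s
    rcons : ∀ {s a t w u} → Step s a t → Run t w u → Run s (a ∷ w) u

  enabled : GState → Ac → Set
  enabled s a = ∃[ t ] Step s a t

  MaximalRun : GState → List Ac → Set
  MaximalRun s u = ∃[ t ] (Run s u t × (∀ a → ¬ enabled t a))

  Indep : Ac → Ac → Set
  Indep a b = ∀ p → p ∈d a → p ∈d b → ⊥

  Swap : List Ac → List Ac → Set
  Swap u w = ∃[ xs ] ∃[ ys ] ∃[ a ] ∃[ b ]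
               (Indep a b × u ≡ xs ++ (a ∷ b ∷ ys) × w ≡ xs ++ (b ∷ a ∷ ys))

  _∼_ : List Ac → List Ac → Set
  _∼_ = Star Swap

  first : List Ac → Ac → Set
  first u b = ∃[ v ] ((b ∷ v) ∼ u)

  ActSet : Set₁
  ActSet = Ac → Set

  ProcSet : Set₁
  ProcSet = Pr → Set

  IFS : GState → ActSet → Set
  IFS s B = ∃[ u ] (MaximalRun s u × (∀ b → first u b → B b))

  domSet : ActSet → ProcSet
  domSet X p = ∃[ a ] (X a × p ∈d a)

  domSeq⊆ : List Ac → ProcSet → Set
  domSeq⊆ x P = All (λ a → ∀ p → p ∈d a → P p) x

  Sticks : ProcSet → GState → Ac → Set
  Sticks R s c = ∃[ p ] ∃[ q ]
    ((((p ≡ cl c) × (q ≡ sv c)) ⊎ ((p ≡ sv c) × (q ≡ cl c)))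
     × R p × ¬ R q × LCan raw q (s q) (c ∷ []))

  Wraps : ProcSet → GState → Set
  Wraps R s = ∀ a → enabled s a → ∃[ p ] (p ∈d a × R p)

  -- C_i for PIFS (restricted = true: dom(x) ⊆ dom(B_i) required) and
  -- for rPIFS (restricted = false: no requirement on x)
  Cset : Bool → GState → ActSet → ActSet
  Cset restricted s Bi c = ∃[ p ] ∃[ b ] ∃[ x ]
    (Bi b × Sticks (λ r → r ≡ p) s c
     × LCan raw p (s p) (b ∷ (x ++ [ c ]))
     × cond restricted x)
    where
      cond : Bool → List Ac → Set
      cond true  x = domSeq⊆ x (domSet Bi)
      cond false x = ⊤

  iterB : Bool → GState → ActSet → ℕ → ActSet
  iterB r s B ℕ.zero    = B
  iterB r s B (ℕ.suc i) = λ c → iterB r s B i c ⊎ Cset r s (iterB r s B i) c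

  PIFS : GState → ActSet → Set
  PIFS s B = Σ ℕ λ k → Wraps (domSet (iterB true s B k)) s

  rPIFS : GState → ActSet → Set
  rPIFS s B = Σ ℕ λ k → Wraps (domSet (iterB false s B k)) s

{-# OPTIONS --safe #-}
-- Walk along a maximal run u from s with first(u) ⊆ B, keeping every process either
-- untouched (in its initial state, not yet involved in u) or moved, with local history
-- b · y since s where b ∈ B_k and dom(y) ⊆ dom(B_k). An action joining two untouched
-- processes commutes to the front of u, so it lies in B; one joining a moved p to an
-- untouched q sticks from {p}, so it lies in C_k; one joining two moved processes has
-- its domain in dom(B_k) already. At the end every process is untouched or in dom(B_k),
-- and an action enabled in s between two untouched processes would still be enabled in
-- the final, deadlocked state; hence dom(B_k) wraps enabled(s). PIFS gives rPIFS because
-- each restricted C_i is contained in its unrestricted counterpart.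
module Submission where

open import Defs
open import Data.Nat using (ℕ; zero; suc)
open import Data.Fin using (_≟_)
open import Data.Bool using (true; false)
open import Data.Maybe using (just)
open import Data.List using (List; []; _∷_; _++_; [_])
open import Data.List.Properties using (++-assoc)
open import Data.List.Relation.Unary.All as All using (All; []; _∷_)
open import Data.List.Relation.Unary.All.Properties using (++⁺)
open import Data.Product using (_×_; ∃-syntax; _,_; proj₁; proj₂)
open import Data.Sum using (_⊎_; inj₁; inj₂)
open import Data.Empty using (⊥-elim)
open import Data.Unit using (tt)
open import Function using (id; _∘_; case_of_)
open import Relation.Nullary using (¬_; Dec; yes; no)
open import Relation.Nullary.Decidable using (_⊎-dec_)
open import Relation.Unary using (_⊆_)
open import Relation.Binary.PropositionalEquality using (_≡_; _≢_; refl; sym; trans; cong; subst)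
open import Relation.Binary.Construct.Closure.ReflexiveTransitive using (ε; _◅_; gmap)

module _ (𝒫 : CSSystem) where
  open CSSystem 𝒫
  open CS 𝒫

  Cset-restricted⊆unrestricted : ∀ {s} {X Y : ActSet} → X ⊆ Y → Cset true s X ⊆ Cset false s Y
  Cset-restricted⊆unrestricted X⊆Y (p , b , x , Xb , sticks , path , _) =
    p , b , x , X⊆Y Xb , sticks , path , tt

  iterB-restricted⊆unrestricted : ∀ {s B} k → iterB true s B k ⊆ iterB false s B k
  iterB-restricted⊆unrestricted zero    B∋c      = B∋c
  iterB-restricted⊆unrestricted (suc k) (inj₁ h) = inj₁ (iterB-restricted⊆unrestricted k h)
  iterB-restricted⊆unrestricted (suc k) (inj₂ h) =
    inj₂ (Cset-restricted⊆unrestricted (iterB-restricted⊆unrestricted k) h)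

  B⊆iterB : ∀ {r s B} k → B ⊆ iterB r s B k
  B⊆iterB zero    B∋c = B∋c
  B⊆iterB (suc k) B∋c = inj₁ (B⊆iterB k B∋c)

  domSet-mono : {X Y : ActSet} → X ⊆ Y → domSet X ⊆ domSet Y
  domSet-mono X⊆Y (a , Xa , pa) = a , X⊆Y Xa , pa

  dom⊆domSet : ∀ {X : ActSet} {a} → X a → ∀ p → p ∈d a → domSet X p
  dom⊆domSet {a = a} Xa p pa = a , Xa , pa

  Wraps-mono : ∀ {R R′ : ProcSet} {s} → R ⊆ R′ → Wraps R s → Wraps R′ s
  Wraps-mono R⊆R′ wraps a en with wraps a en
  ... | p , pa , Rp = p , pa , R⊆R′ Rp

  PIFS⇒rPIFS : ∀ s B → PIFS s B → rPIFS s B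
  PIFS⇒rPIFS s B (k , wraps) =
    k , Wraps-mono (domSet-mono (iterB-restricted⊆unrestricted k)) wraps

  cl≢sv : ∀ a → cl a ≢ sv a
  cl≢sv a eq with trans (sym (cl-client a)) (trans (cong isClient eq) (sv-server a))
  ... | ()

  _∈d?_ : ∀ r a → Dec (r ∈d a)
  r ∈d? a = (r ≟ cl a) ⊎-dec (r ≟ sv a)

  Partners : Ac → Pr → Pr → Set
  Partners a p q = (p ≡ cl a × q ≡ sv a) ⊎ (p ≡ sv a × q ≡ cl a)

  Partners⇒≢ : ∀ {a p q} → Partners a p q → q ≢ p
  Partners⇒≢ {a} (inj₁ (refl , refl)) = cl≢sv a ∘ sym
  Partners⇒≢ {a} (inj₂ (refl , refl)) = cl≢sv a

  Partners⇒∈d : ∀ {a p q} → Partners a p q → p ∈d a × q ∈d a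
  Partners⇒∈d (inj₁ (refl , refl)) = inj₁ refl , inj₂ refl
  Partners⇒∈d (inj₂ (refl , refl)) = inj₂ refl , inj₁ refl

  Indep-if-∉ : ∀ {a c} → ¬ cl a ∈d c × ¬ sv a ∈d c → Indep a c
  Indep-if-∉ (cl∉c , _) p (inj₁ refl) pc = cl∉c pc
  Indep-if-∉ (_ , sv∉c) p (inj₂ refl) pc = sv∉c pc

  ∼-cons : ∀ c {u w} → u ∼ w → (c ∷ u) ∼ (c ∷ w)
  ∼-cons c = gmap (c ∷_) λ { (xs , ys , a , b , ind , refl , refl) → c ∷ xs , ys , a , b , ind , refl , refl }

  ∼-commute-prefix : ∀ {a} v w → All (Indep a) v → (a ∷ v ++ w) ∼ (v ++ a ∷ w)
  ∼-commute-prefix []      w []           = ε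
  ∼-commute-prefix (c ∷ v) w (ind ∷ inds) =
    ([] , v ++ w , _ , c , ind , refl , refl) ◅ ∼-cons c (∼-commute-prefix v w inds)

  first-after-independent-prefix : ∀ {a} v w → All (Indep a) v → first (v ++ a ∷ w) a
  first-after-independent-prefix v w inds = v ++ w , ∼-commute-prefix v w inds

  LPath-snoc : ∀ {r x w y a z} → LPath raw r x w y → δ r y a ≡ just z → LPath raw r x (w ++ [ a ]) z
  LPath-snoc lnil           step = lcons step lnil
  LPath-snoc (lcons e path) step = lcons e (LPath-snoc path step)

  LPath-head-∈d : ∀ {r x b w y} → LPath raw r x (b ∷ w) y → r ∈d b
  LPath-head-∈d (lcons e _) = δ-Σ _ _ _ λ e≡nothing → case trans (sym e) e≡nothing of λ ()

  enabled-transfer : ∀ {s s′ e a} → Step s a s′ → (∀ r → r ∈d a → e r ≡ s r) → enabled e a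
  enabled-transfer {s} {s′} {e} {a} (moves , _) agree = e′ , moves′ , frame′
    where
      e′ : GState
      e′ r with r ∈d? a
      ... | yes _ = s′ r
      ... | no  _ = e r

      moves′ : ∀ r → r ∈d a → δ r (e r) a ≡ just (e′ r)
      moves′ r ra with r ∈d? a
      ... | yes _   = subst (λ z → δ r z a ≡ just (s′ r)) (sym (agree r ra)) (moves r ra)
      ... | no  r∉a = ⊥-elim (r∉a ra)

      frame′ : ∀ r → ¬ r ∈d a → e′ r ≡ e r
      frame′ r r∉a with r ∈d? a
      ... | yes ra = ⊥-elim (r∉a ra)
      ... | no  _  = refl

  stuck-wraps : ∀ {s e} {R : ProcSet} → (∀ a → ¬ enabled e a)
              → (∀ r → e r ≡ s r ⊎ R r) → Wraps R s
  stuck-wraps {s} {e} dead home-or-R a (_ , step) with home-or-R (cl a) | home-or-R (sv a)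
  ... | inj₂ R-cl | _         = cl a , inj₁ refl , R-cl
  ... | inj₁ _    | inj₂ R-sv = sv a , inj₂ refl , R-sv
  ... | inj₁ cl-home | inj₁ sv-home = ⊥-elim (dead a (enabled-transfer step agree))
    where
      agree : ∀ r → r ∈d a → e r ≡ s r
      agree r (inj₁ refl) = cl-home
      agree r (inj₂ refl) = sv-home

  module _ (s : GState) where

    Untouched : List Ac → (r : Pr) → LState raw r → Set
    Untouched v r x = x ≡ s r × All (λ c → ¬ r ∈d c) v

    Moved : ActSet → (r : Pr) → LState raw r → Set
    Moved X r x = ∃[ b ] ∃[ y ] (X b × domSeq⊆ y (domSet X) × LPath raw r (s r) (b ∷ y) x)

    Inv : List Ac → ActSet → GState → Set
    Inv v X t = ∀ r → Untouched v r (t r) ⊎ Moved X r (t r)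

    Moved-mono : ∀ {X Y r x} → X ⊆ Y → Moved X r x → Moved Y r x
    Moved-mono X⊆Y (b , y , Xb , dom-y , path) =
      b , y , X⊆Y Xb , All.map (λ dom-c p pc → domSet-mono X⊆Y (dom-c p pc)) dom-y , path

    Moved⇒domSet : ∀ {X r x} → Moved X r x → domSet X r
    Moved⇒domSet (b , _ , Xb , _ , path) = b , Xb , LPath-head-∈d path

    Untouched-frame : ∀ {v r t a t′} → Step t a t′ → ¬ r ∈d a
                    → Untouched v r (t r) → Untouched (v ++ [ a ]) r (t′ r)
    Untouched-frame (_ , frame) r∉a (home , r∉v) = trans (frame _ r∉a) home , ++⁺ r∉v (r∉a ∷ [])

    Moved-frame : ∀ {X r t a t′} → Step t a t′ → ¬ r ∈d a → Moved X r (t r) → Moved X r (t′ r)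
    Moved-frame {r = r} (_ , frame) r∉a (b , y , Xb , dom-y , path) =
      b , y , Xb , dom-y , subst (LPath raw r (s r) (b ∷ y)) (sym (frame r r∉a)) path

    Untouched-step : ∀ {X v r t a t′} → Step t a t′ → r ∈d a → X a
                   → Untouched v r (t r) → Moved X r (t′ r)
    Untouched-step {r = r} {a = a} {t′} (moves , _) ra Xa (home , _) =
      a , [] , Xa , [] , lcons (subst (λ z → δ r z a ≡ just (t′ r)) home (moves r ra)) lnil

    Moved-step : ∀ {X r t a t′} → Step t a t′ → r ∈d a → (∀ p → p ∈d a → domSet X p)
               → Moved X r (t r) → Moved X r (t′ r)
    Moved-step {r = r} (moves , _) ra dom-a (b , y , Xb , dom-y , path) =
      b , _ , Xb , ++⁺ dom-y (dom-a ∷ []) , LPath-snoc path (moves r ra)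

    Moved-step-sticks : ∀ {X p q t a t′} → Step t a t′ → Partners a p q
                      → Moved X p (t p) → t q ≡ s q → Cset true s X a
    Moved-step-sticks {p = p} {q} {a = a} {t′} (moves , _) partners (b , y , Xb , dom-y , path) q-home =
      p , b , y , Xb ,
      (p , q , partners , refl , Partners⇒≢ partners ,
       t′ q , lcons (subst (λ z → δ q z a ≡ just (t′ q)) q-home (moves q q∈a)) lnil) ,
      (t′ p , LPath-snoc path (moves p p∈a)) , dom-y
      where
        p∈a = proj₁ (Partners⇒∈d partners)
        q∈a = proj₂ (Partners⇒∈d partners)

    Inv-initial : ∀ {X} → Inv [] X s
    Inv-initial r = inj₁ (refl , [])

    Inv-extend : ∀ {v X Y t a t′} → Inv v X t → Step t a t′ → X ⊆ Y
               → Moved Y (cl a) (t′ (cl a)) → Moved Y (sv a) (t′ (sv a)) → Inv (v ++ [ a ]) Y t′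
    Inv-extend {a = a} inv step X⊆Y moved-cl moved-sv r with r ∈d? a
    ... | yes (inj₁ refl) = inj₂ moved-cl
    ... | yes (inj₂ refl) = inj₂ moved-sv
    ... | no r∉a with inv r
    ...   | inj₁ untouched = inj₁ (Untouched-frame step r∉a untouched)
    ...   | inj₂ moved     = inj₂ (Moved-frame step r∉a (Moved-mono X⊆Y moved))

    Inv⇒home-or-domSet : ∀ {v X t} → Inv v X t → ∀ r → t r ≡ s r ⊎ domSet X r
    Inv⇒home-or-domSet inv r with inv r
    ... | inj₁ (home , _) = inj₁ home
    ... | inj₂ moved      = inj₂ (Moved⇒domSet moved)

    module _ (B : ActSet) where

      Bk : ℕ → ActSet
      Bk = iterB true s B

      Inv-step : ∀ {v t a t′} k w → Inv v (Bk k) t → Step t a t′ → first (v ++ a ∷ w) ⊆ B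
               → ∃[ k′ ] Inv (v ++ [ a ]) (Bk k′) t′
      Inv-step {v} {a = a} k w inv step firsts with inv (cl a) | inv (sv a)
      ... | inj₁ untouched-cl | inj₁ untouched-sv =
        k , Inv-extend inv step id (Untouched-step step (inj₁ refl) a∈Bk untouched-cl)
                                   (Untouched-step step (inj₂ refl) a∈Bk untouched-sv)
        where
          a∈Bk : Bk k a
          a∈Bk = B⊆iterB k (firsts (first-after-independent-prefix v w
                   (All.zipWith Indep-if-∉ (proj₂ untouched-cl , proj₂ untouched-sv))))
      ... | inj₂ moved-cl | inj₁ untouched-sv =
        suc k , Inv-extend inv step inj₁
                  (Moved-step step (inj₁ refl) (dom⊆domSet a∈Bk) (Moved-mono inj₁ moved-cl))
                  (Untouched-step step (inj₂ refl) a∈Bk untouched-sv)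
        where
          a∈Bk : Bk (suc k) a
          a∈Bk = inj₂ (Moved-step-sticks step (inj₁ (refl , refl)) moved-cl (proj₁ untouched-sv))
      ... | inj₁ untouched-cl | inj₂ moved-sv =
        suc k , Inv-extend inv step inj₁
                  (Untouched-step step (inj₁ refl) a∈Bk untouched-cl)
                  (Moved-step step (inj₂ refl) (dom⊆domSet a∈Bk) (Moved-mono inj₁ moved-sv))
        where
          a∈Bk : Bk (suc k) a
          a∈Bk = inj₂ (Moved-step-sticks step (inj₂ (refl , refl)) moved-sv (proj₁ untouched-cl))
      ... | inj₂ moved-cl | inj₂ moved-sv =
        k , Inv-extend inv step id (Moved-step step (inj₁ refl) dom-a moved-cl)
                                   (Moved-step step (inj₂ refl) dom-a moved-sv)
        where
          dom-a : ∀ p → p ∈d a → domSet (Bk k) p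
          dom-a p (inj₁ refl) = Moved⇒domSet moved-cl
          dom-a p (inj₂ refl) = Moved⇒domSet moved-sv

      Inv-run : ∀ v k {t w e} → Inv v (Bk k) t → Run t w e → first (v ++ w) ⊆ B
              → ∃[ k′ ] (∀ r → e r ≡ s r ⊎ domSet (Bk k′) r)
      Inv-run v k inv rnil firsts = k , Inv⇒home-or-domSet inv
      Inv-run v k {w = a ∷ w} inv (rcons step run) firsts with Inv-step k w inv step firsts
      ... | k′ , inv′ =
        Inv-run (v ++ [ a ]) k′ inv′ run (firsts ∘ subst (λ u → first u _) (++-assoc v [ a ] w))

      IFS⇒PIFS : IFS s B → PIFS s B
      IFS⇒PIFS (_ , (_ , run , dead) , firsts) with Inv-run [] 0 Inv-initial run (λ {b} → firsts b)
      ... | k , home-or-domSet = k , stuck-wraps dead home-or-domSet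

lemma9p4 : (𝒫 : CSSystem) (s : CS.GState 𝒫) (B : CS.ActSet 𝒫) →
    (CS.IFS 𝒫 s B → CS.PIFS 𝒫 s B) × (CS.PIFS 𝒫 s B → CS.rPIFS 𝒫 s B)
lemma9p4 𝒫 s B = IFS⇒PIFS 𝒫 s B , PIFS⇒rPIFS 𝒫 s B
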